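{- Let $(X,\mathcal{T},(I_i)_{i\in\mathbb{N}})$ be a computable topological space with proper characteristic relations $\mathcal{C},\mathcal{D}$. Let $K$ and $L$ be nonempty disjoint compact sets in $(X,\mathcal{T})$. Then there exist $a,b\in\mathbb{N}$ such that $K\subseteq J_a$, $L\subseteq J_b$ and $J_a\diamond_{\mathcal{D}}J_b$.
   Context: Fix a computably finite valued function $j\mapsto[j]$ from $\mathbb{N}$ onto the nonempty finite subsets of $\mathbb{N}$. A computable topological space is a triple $(X,\mathcal{T},(I_i))$ with $\{I_i\}\subseteq\mathcal{T}$ a basis and c.e. sets $\mathcal{C},\mathcal{D}\subseteq\mathbb{N}^2$ such that: (1) $(i,j)\in\mathcal{D}\Rightarrow I_i\cap I_j=\emptyset$; (2) $(i,j)\in\mathcal{C}\Rightarrow I_i\subseteq I_j$; (3) for $x\neq y$ there are $i,j$ with $x\in I_i$, $y\in I_j$, $(i,j)\in\mathcal{D}$; (4) if $x\in I_i\cap I_j$ there is $k$ with $x\in I_k$, $(k,i),(k,j)\in\mathcal{C}$. They are proper if also (5) $\mathcal{D}$ is symmetric; (6) $\mathcal{C}$ is reflexive and transitive; (7) $(k,i)\in\mathcal{C}$ and $(i,j)\in\mathcal{D}$ imply $(k,j)\in\mathcal{D}$. $J_j=\bigcup_{i\in[j]}I_i$; $J_a\diamond_{\mathcal{D}}J_b$ means $(i,j)\in\mathcal{D}$ for all $i\in[a]$ and $j\in[b]$. -}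

module Defs where

open import Data.Nat using (ℕ)
open import Data.Empty using (⊥)
open import Data.Unit using (⊤)
open import Data.Product using (Σ; ∃; _×_)
open import Data.List using (List; [])
open import Data.List.Membership.Propositional using (_∈_)
open import Data.List.Relation.Unary.Any using (Any)
open import Relation.Nullary using (¬_)
open import Relation.Binary.PropositionalEquality using (_≡_)
open import Function.Bundles using (_⇔_)

Subset : Set → Set₁
Subset X = X → Set

_⊆_ : {X : Set} → Subset X → Subset X → Set
U ⊆ V = ∀ x → U x → V x

record IsTopology (X : Set) (Open : Subset X → Set) : Set₁ where
  field
    open-whole : Open (λ _ → ⊤)
    open-empty : Open (λ _ → ⊥)
    open-∩     : ∀ {U V} → Open U → Open V → Open (λ x → U x × V x)
    open-⋃     : {Idx : Set} (F : Idx → Subset X) →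
                 (∀ i → Open (F i)) → Open (λ x → Σ Idx (λ i → F i x))

-- The fixed surjection j ↦ [j] from ℕ onto the nonempty finite subsets of ℕ
-- (finite sets represented by lists, compared extensionally by membership).
record FiniteSetCoding : Set where
  field
    [_]      : ℕ → List ℕ
    nonempty : ∀ j → ¬ ([ j ] ≡ [])
    onto     : (s : List ℕ) → ¬ (s ≡ []) →
               ∃ λ j → ∀ n → (n ∈ [ j ]) ⇔ (n ∈ s)

-- A computable topological space (X, T, (I_i)) with characteristic
-- relations C, D satisfying (1)–(4); the c.e.-ness of C, D is not recorded
--.
record ComputableTopologicalSpace : Set₁ where
  field
    X      : Set
    Open   : Subset X → Set
    isTop  : IsTopology X Open
    I      : ℕ → Subset X
    I-open : ∀ i → Open (I i)
    basis  : ∀ U → Open U → ∀ x → U x → ∃ λ i → I i x × (I i ⊆ U)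
    𝒞      : ℕ → ℕ → Set
    𝒟      : ℕ → ℕ → Set
    ax1    : ∀ i j → 𝒟 i j → ∀ x → I i x → I j x → ⊥
    ax2    : ∀ i j → 𝒞 i j → I i ⊆ I j
    ax3    : ∀ x y → ¬ (x ≡ y) →
             ∃ λ i → ∃ λ j → I i x × I j y × 𝒟 i j
    ax4    : ∀ x i j → I i x → I j x →
             ∃ λ k → I k x × 𝒞 k i × 𝒞 k j

record IsProper (S : ComputableTopologicalSpace) : Set where
  open ComputableTopologicalSpace S
  field
    𝒟-sym   : ∀ i j → 𝒟 i j → 𝒟 j i
    𝒞-refl  : ∀ i → 𝒞 i i
    𝒞-trans : ∀ i j k → 𝒞 i j → 𝒞 j k → 𝒞 i k
    ax7     : ∀ k i j → 𝒞 k i → 𝒟 i j → 𝒟 k j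

module _ (S : ComputableTopologicalSpace) where
  open ComputableTopologicalSpace S

  IsCompact : Subset X → Set₁
  IsCompact K = {Idx : Set} (U : Idx → Subset X) → (∀ i → Open (U i)) →
                (∀ x → K x → ∃ λ i → U i x) →
                ∃ λ (fs : List Idx) → ∀ x → K x → Any (λ i → U i x) fs

  module _ (cod : FiniteSetCoding) where
    open FiniteSetCoding cod

    J : ℕ → Subset X
    J j x = Any (λ i → I i x) [ j ]

    _◇_ : ℕ → ℕ → Set
    a ◇ b = ∀ i j → i ∈ [ a ] → j ∈ [ b ] → 𝒟 i j

-- Around each point x of K a single basic set I_k is 𝒟-disjoint from a finite
-- basic cover of L: separate x from every point of L by (3), take a finite
-- subcover of L, and intersect the finitely many neighbourhoods of x by (4);
-- by (7) the intersection inherits all the 𝒟-relations. Finitely many such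
-- I_k cover K, and the same argument with the roles of K and L exchanged
-- (using (5)) produces a finite cover of L 𝒟-disjoint from each of them.
module Submission where

open import Defs
open import Data.Empty using (⊥)
open import Data.Nat using (ℕ)
open import Data.Unit using (tt)
open import Data.Product using (∃; _×_; _,_; proj₁; proj₂)
open import Data.List using (List; []; _∷_; map)
open import Data.List.Relation.Unary.Any using (Any)
open import Data.List.Relation.Unary.Any.Properties using (map⁺)
open import Data.List.Relation.Unary.All as All using (All; []; _∷_)
import Data.List.Relation.Unary.All.Properties as All
open import Data.List.Membership.Propositional using (_∈_; find; lose)
open import Relation.Nullary using (¬_)
open import Relation.Binary.PropositionalEquality using (_≡_; refl)
open import Function.Bundles using (Equivalence)

module _ (S : ComputableTopologicalSpace) where
  open ComputableTopologicalSpace S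
  open IsTopology isTop using (open-whole)

  ⋃I : List ℕ → Subset X
  ⋃I is x = Any (λ i → I i x) is

  basic-nbhd : ∀ x → ∃ λ i → I i x
  basic-nbhd x = let i , x∈Iᵢ , _ = basis _ open-whole x tt in i , x∈Iᵢ

  compact⇒finite-basic-subcover : ∀ {K} → IsCompact S K → (P : ℕ → Set) →
    (∀ x → K x → ∃ λ i → I i x × P i) →
    ∃ λ is → K ⊆ ⋃I is × All P is
  compact⇒finite-basic-subcover {K} cK P nbhd =
    let ps , K⊆ = cK (λ p → I (index p)) (λ _ → I-open _)
                     (λ x Kx → (x , Kx) , proj₁ (proj₂ (nbhd x Kx)))
    in  map index ps , (λ x Kx → map⁺ (K⊆ x Kx)) , All.map⁺ (All.tabulate λ {p} _ → property p)
    where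
    index : ∃ K → ℕ
    index (x , Kx) = proj₁ (nbhd x Kx)

    property : (p : ∃ K) → P (index p)
    property (x , Kx) = proj₂ (proj₂ (nbhd x Kx))

  covered-nonempty : ∀ {K is} → ∃ K → K ⊆ ⋃I is → ¬ (is ≡ [])
  covered-nonempty (x , Kx) K⊆ refl with K⊆ x Kx
  ... | ()

  module _ (pr : IsProper S) where
    open IsProper pr

    𝒟-shrinkˡ : ∀ x js → All (λ j → ∃ λ i → I i x × 𝒟 i j) js →
      ∃ λ k → I k x × All (𝒟 k) js
    𝒟-shrinkˡ x [] [] = let i , x∈Iᵢ = basic-nbhd x in i , x∈Iᵢ , []
    𝒟-shrinkˡ x (j ∷ js) ((i , x∈Iᵢ , 𝒟ij) ∷ seps)
      with 𝒟-shrinkˡ x js seps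
    ... | k′ , x∈Iₖ′ , 𝒟k′js with ax4 x i k′ x∈Iᵢ x∈Iₖ′
    ... | k , x∈Iₖ , 𝒞ki , 𝒞kk′ =
      k , x∈Iₖ , ax7 k i j 𝒞ki 𝒟ij ∷ All.map (ax7 k k′ _ 𝒞kk′) 𝒟k′js

    𝒟-shrinkʳ : ∀ y ks → All (λ k → ∃ λ j → I j y × 𝒟 k j) ks →
      ∃ λ l → I l y × All (λ k → 𝒟 k l) ks
    𝒟-shrinkʳ y ks seps =
      let l , y∈Iₗ , 𝒟lks = 𝒟-shrinkˡ y ks (All.map flip seps)
      in  l , y∈Iₗ , All.map (𝒟-sym _ _) 𝒟lks
      where
      flip : ∀ {k} → (∃ λ j → I j y × 𝒟 k j) → ∃ λ j → I j y × 𝒟 j k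
      flip (j , y∈Iⱼ , 𝒟kj) = j , y∈Iⱼ , 𝒟-sym _ _ 𝒟kj

    point-compact-separation : ∀ x {L} → IsCompact S L → (∀ y → L y → ¬ (x ≡ y)) →
      ∃ λ k → ∃ λ js → I k x × L ⊆ ⋃I js × All (𝒟 k) js
    point-compact-separation x {L} cL x∉L =
      let js , L⊆ , seps = compact⇒finite-basic-subcover cL _ separate
          k , x∈Iₖ , 𝒟kjs = 𝒟-shrinkˡ x js seps
      in  k , js , x∈Iₖ , L⊆ , 𝒟kjs
      where
      separate : ∀ y → L y → ∃ λ j → I j y × ∃ λ i → I i x × 𝒟 i j
      separate y Ly = let i , j , x∈Iᵢ , y∈Iⱼ , 𝒟ij = ax3 x y (x∉L y Ly)
                      in  j , y∈Iⱼ , i , x∈Iᵢ , 𝒟ij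

    compact-compact-separation : ∀ {K L} → IsCompact S K → IsCompact S L →
      (∀ x → K x → L x → ⊥) →
      ∃ λ ks → ∃ λ ls → K ⊆ ⋃I ks × L ⊆ ⋃I ls × All (λ l → All (λ k → 𝒟 k l) ks) ls
    compact-compact-separation {K} {L} cK cL disjoint =
      let ks , K⊆ , separatedₖ = compact⇒finite-basic-subcover cK _ separateᴷ
          ls , L⊆ , separatedₗ = compact⇒finite-basic-subcover cL _ (separateᴸ ks separatedₖ)
      in  ks , ls , K⊆ , L⊆ , separatedₗ
      where
      Separated : ℕ → Set
      Separated k = ∃ λ js → L ⊆ ⋃I js × All (𝒟 k) js

      separateᴷ : ∀ x → K x → ∃ λ k → I k x × Separated k
      separateᴷ x Kx =
        let k , js , x∈Iₖ , L⊆ , 𝒟kjs =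
              point-compact-separation x cL (λ { y Ly refl → disjoint x Kx Ly })
        in  k , x∈Iₖ , js , L⊆ , 𝒟kjs

      separateᴸ : ∀ ks → All Separated ks → ∀ y → L y →
        ∃ λ l → I l y × All (λ k → 𝒟 k l) ks
      separateᴸ ks separated y Ly = 𝒟-shrinkʳ y ks (All.map covering separated)
        where
        covering : ∀ {k} → Separated k → ∃ λ j → I j y × 𝒟 k j
        covering (js , L⊆ , 𝒟kjs) =
          let j , j∈js , y∈Iⱼ = find (L⊆ y Ly) in j , y∈Iⱼ , All.lookup 𝒟kjs j∈js

  module _ (cod : FiniteSetCoding) where
    open FiniteSetCoding cod

    encode : ∀ {K} is → ∃ K → K ⊆ ⋃I is →
      ∃ λ a → K ⊆ J S cod a × (∀ {i} → i ∈ [ a ] → i ∈ is)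
    encode is (x , Kx) K⊆ =
      let a , [a]≈is = onto is (covered-nonempty (x , Kx) K⊆)
      in  a , (λ y Ky → let i , i∈is , y∈Iᵢ = find (K⊆ y Ky)
                        in  lose (Equivalence.from ([a]≈is i) i∈is) y∈Iᵢ)
            , (λ {i} → Equivalence.to ([a]≈is i))

lemma4p6 : (cod : FiniteSetCoding) (S : ComputableTopologicalSpace) →
    IsProper S →
    (K L : ComputableTopologicalSpace.X S →  Set) →
    IsCompact S K → IsCompact S L →
    ∃ K → ∃ L →
    (∀ x → K x → L x → ⊥) →
    ∃ λ (a : ℕ) → ∃ λ (b : ℕ) →
    (K ⊆ J S cod a) × (L ⊆ J S cod b) × _◇_ S cod a b
lemma4p6 cod S pr K L cK cL inhabitedK inhabitedL disjoint =
  let ks , ls , K⊆ , L⊆ , separated = compact-compact-separation S pr cK cL disjoint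
      a , K⊆Jᵃ , [a]⊆ks = encode S cod ks inhabitedK K⊆
      b , L⊆Jᵇ , [b]⊆ls = encode S cod ls inhabitedL L⊆
  in  a , b , K⊆Jᵃ , L⊆Jᵇ ,
      λ i j i∈[a] j∈[b] → All.lookup (All.lookup separated ([b]⊆ls j∈[b])) ([a]⊆ks i∈[a])
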